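{- Let $r\ge1$ be an integer. There exists a routing algorithm for $r$-central routing on the full-duplex infinite square grid (store-and-forward $\Delta$-port model) that delivers all packets in exactly $\binom{r+1}{2}$ steps; this is optimal, since no schedule can deliver all packets in fewer than $\binom{r+1}{2}$ steps.
   Context: Square grid: the infinite graph on $\mathbb{Z}^2$ with $(x,y)$ adjacent to $(x\pm1,y)$ and $(x,y\pm1)$. $r$-central routing: a central node $v$ is fixed and every node at distance between $1$ and $r$ from $v$ holds exactly one packet whose destination is $v$. Routing model: time proceeds in synchronous steps; in each step each packet either stays at its current node (unbounded queues) or moves along one incident edge; a node may use all its incident edges simultaneously; full-duplex: each edge can be traversed by at most one packet per step in each direction. The running time is the number of steps until all packets have reached their destination. -}

module Defs where

open import Data.Nat using (ℕ; zero; suc; _+_; _≤_; _<_)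
open import Data.Integer as ℤ using (ℤ; ∣_∣; _-_; 1ℤ)
open import Data.Product using (Σ; _×_; _,_; proj₁; proj₂)
open import Data.Sum using (_⊎_)
open import Relation.Binary.PropositionalEquality using (_≡_; _≢_)
open import Relation.Nullary using (¬_)

Node : Set
Node = ℤ × ℤ

Adj : Node → Node → Set
Adj (x , y) b =
  (b ≡ (x ℤ.+ 1ℤ , y)) ⊎ (b ≡ (x - 1ℤ , y)) ⊎
  (b ≡ (x , y ℤ.+ 1ℤ)) ⊎ (b ≡ (x , y - 1ℤ))

dist : Node → Node → ℕ
dist (x₁ , y₁) (x₂ , y₂) = ∣ x₁ - x₂ ∣ + ∣ y₁ - y₂ ∣

-- Packets of r-central routing towards v: one packet per node u with
-- 1 ≤ dist u v ≤ r; a packet is identified with its source node.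
Packet : Node → ℕ → Set
Packet v r = Σ Node (λ u → (1 ≤ dist u v) × (dist u v ≤ r))

source : ∀ {v r} → Packet v r → Node
source = proj₁

StepMove : Node → Node → Set
StepMove a b = (a ≡ b) ⊎ Adj a b

record Schedule (v : Node) (r : ℕ) (T : ℕ) : Set where
  field
    pos      : Packet v r → ℕ → Node
    start    : ∀ p → pos p 0 ≡ source p
    move     : ∀ p t → t < T → StepMove (pos p t) (pos p (suc t))
    -- full duplex: in each step, each directed edge (a → b) is traversed
    -- by at most one packet (unbounded queues, all ports usable at once)
    capacity : ∀ p q t → t < T → source p ≢ source q →
               pos p t ≢ pos p (suc t) →
               ¬ ((pos p t ≡ pos q t) × (pos p (suc t) ≡ pos q (suc t)))
    delivered : ∀ p → pos p T ≡ v

module Submission where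

-- Geometry.  Every node u ≠ v is  v ⊕ emb q (suc a) b  for a unique cell
-- (q , a , b): a quadrant q (a rotated copy of ℕ × ℕ) and local coordinates.
--
-- Upper bound.  The packet of cell (q , a , b) waits, then walks a shortest
-- route to v (second coordinate first) so as to arrive exactly at time
-- pair a b + 1 ≤ tri r, where  pair a b = tri (a + b) + b  is the Cantor
-- numbering.  A packet moving at step t sits at distance k with
-- t + k = its arrival time; since the node also determines the quadrant and
-- pair is injective, two packets never leave the same node at the same step.
--
-- Lower bound.  There are 4 · tri r packets; each enters v at some step
-- t < T through one of the 4 neighbours of v, and by the full-duplex
-- constraint distinct packets use distinct slots (t , neighbour), so
-- 4 · tri r ≤ 4 · T by the pigeonhole principle.

open import Defs
open import Data.Nat using (ℕ; suc; _≤_; _<_)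
open import Data.Nat.Combinatorics using (_C_)
open import Data.Product using (_×_)
open import Relation.Nullary using (¬_)

open import Data.Nat using (zero; _+_; _*_; _∸_; _⊓_; z≤n; s≤s; _≤?_)
import Data.Nat.Properties as ℕₚ
open import Data.Nat.Combinatorics using (nC1≡n; nCk+nC[k+1]≡[n+1]C[k+1])
open import Data.Integer as ℤ using (ℤ; +_; -[1+_]; +[1+_]; +0; ∣_∣; 1ℤ; -1ℤ; _-_)
import Data.Integer.Properties as ℤₚ
open import Data.Integer.Tactic.RingSolver using (solve-∀)
open import Data.Fin using (Fin; toℕ; fromℕ<; splitAt; join; combine; remQuot)
open import Data.Fin.Patterns using (0F; 1F; 2F; 3F)
import Data.Fin.Properties as Finₚ
open import Data.Product using (Σ; _,_; proj₁; proj₂; uncurry)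
import Data.Product.Properties as Productₚ
open import Data.Sum using (_⊎_; inj₁; inj₂; [_,_]′)
open import Data.Maybe using (Maybe; just; nothing)
import Data.Maybe.Properties as Maybeₚ
open import Data.Empty using (⊥-elim)
open import Function using (_∘_)
open import Function.Definitions using (Injective)
open import Relation.Nullary using (yes; no)
open import Relation.Nullary.Decidable using (decidable-stable)
open import Relation.Binary using (DecidableEquality; tri<; tri≈; tri>)
open import Relation.Binary.PropositionalEquality

_⊕_ : Node → Node → Node
(a , b) ⊕ (e , f) = (a ℤ.+ e , b ℤ.+ f)

_⊖_ : Node → Node → Node
(a , b) ⊖ (c , d) = (a - c , b - d)

origin : Node
origin = (+0 , +0)

norm : Node → ℕ
norm (x , y) = ∣ x ∣ + ∣ y ∣

⊕-⊖ : ∀ v e → (v ⊕ e) ⊖ v ≡ e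
⊕-⊖ (a , b) (e , f) = cong₂ _,_ (cancel a e) (cancel b f)
  where
  cancel : ∀ (a e : ℤ) → (a ℤ.+ e) - a ≡ e
  cancel = solve-∀

⊖-⊕ : ∀ u v → v ⊕ (u ⊖ v) ≡ u
⊖-⊕ (a , b) (c , d) = cong₂ _,_ (restore c a) (restore d b)
  where
  restore : ∀ (c a : ℤ) → c ℤ.+ (a - c) ≡ a
  restore = solve-∀

⊕-origin : ∀ v → v ⊕ origin ≡ v
⊕-origin (a , b) = cong₂ _,_ (ℤₚ.+-identityʳ a) (ℤₚ.+-identityʳ b)

⊕-cancelˡ : ∀ v {e e'} → v ⊕ e ≡ v ⊕ e' → e ≡ e'
⊕-cancelˡ v {e} {e'} eq = trans (sym (⊕-⊖ v e)) (trans (cong (_⊖ v) eq) (⊕-⊖ v e'))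

dist-self : ∀ v → dist v v ≡ 0
dist-self (x , y) = cong₂ _+_ (cong ∣_∣ (ℤₚ.+-inverseʳ x)) (cong ∣_∣ (ℤₚ.+-inverseʳ y))

-- The four quadrants: quadrant k is the image of ℕ × ℕ under k quarter turns.
-- Every nonzero vector is  emb q (suc a) b  for exactly one (q , a , b).
Quadrant : Set
Quadrant = Fin 4

emb : Quadrant → ℕ → ℕ → Node
emb 0F x y = (+ x , + y)
emb 1F x y = (ℤ.- (+ y) , + x)
emb 2F x y = (ℤ.- (+ x) , ℤ.- (+ y))
emb 3F x y = (+ y , ℤ.- (+ x))

norm-emb : ∀ q x y → norm (emb q x y) ≡ x + y
norm-emb 0F x y = refl
norm-emb 1F x y =
  trans (cong (_+ x) (ℤₚ.∣-i∣≡∣i∣ (+ y))) (ℕₚ.+-comm y x)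
norm-emb 2F x y =
  cong₂ _+_ (ℤₚ.∣-i∣≡∣i∣ (+ x)) (ℤₚ.∣-i∣≡∣i∣ (+ y))
norm-emb 3F x y =
  trans (cong (λ n → y + n) (ℤₚ.∣-i∣≡∣i∣ (+ x))) (ℕₚ.+-comm y x)

emb-origin : ∀ q → emb q 0 0 ≡ origin
emb-origin 0F = refl
emb-origin 1F = refl
emb-origin 2F = refl
emb-origin 3F = refl

dist-⊕-emb : ∀ v q x y → dist (v ⊕ emb q x y) v ≡ x + y
dist-⊕-emb v q x y = trans (cong norm (⊕-⊖ v (emb q x y))) (norm-emb q x y)

Cell : Set
Cell = Quadrant × ℕ × ℕ

point : Cell → Node
point (q , a , b) = emb q (suc a) b

polar : Node → Maybe Cell
polar (+[1+ a ] , + b)       = just (0F , a , b)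
polar (+0       , +[1+ a ])  = just (1F , a , 0)
polar (-[1+ n ] , +[1+ a ])  = just (1F , a , suc n)
polar (-[1+ a ] , +0)        = just (2F , a , 0)
polar (-[1+ a ] , -[1+ n ])  = just (2F , a , suc n)
polar (+0       , -[1+ a ])  = just (3F , a , 0)
polar (+[1+ b ] , -[1+ a ])  = just (3F , a , suc b)
polar (+0       , +0)        = nothing

polar-point : ∀ c → polar (point c) ≡ just c
polar-point (0F , a , b) = refl
polar-point (1F , a , zero) = refl
polar-point (1F , a , suc b) = refl
polar-point (2F , a , zero) = refl
polar-point (2F , a , suc b) = refl
polar-point (3F , a , zero) = refl
polar-point (3F , a , suc b) = refl

polar-just : ∀ e {c} → polar e ≡ just c → e ≡ point c
polar-just (+[1+ a ] , + b)      refl = refl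
polar-just (+0       , +[1+ a ]) refl = refl
polar-just (-[1+ n ] , +[1+ a ]) refl = refl
polar-just (-[1+ a ] , +0)       refl = refl
polar-just (-[1+ a ] , -[1+ n ]) refl = refl
polar-just (+0       , -[1+ a ]) refl = refl
polar-just (+[1+ b ] , -[1+ a ]) refl = refl

polar-nothing : ∀ e → polar e ≡ nothing → norm e ≡ 0
polar-nothing (+0       , +0)       refl = refl
polar-nothing (+[1+ a ] , + b)      ()
polar-nothing (+0       , +[1+ a ]) ()
polar-nothing (-[1+ n ] , +[1+ a ]) ()
polar-nothing (-[1+ a ] , +0)       ()
polar-nothing (-[1+ a ] , -[1+ n ]) ()
polar-nothing (+0       , -[1+ a ]) ()
polar-nothing (+[1+ b ] , -[1+ a ]) ()

point-injective : ∀ {c c'} → point c ≡ point c' → c ≡ c'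
point-injective {c} {c'} e =
  Maybeₚ.just-injective (trans (sym (polar-point c)) (trans (cong polar e) (polar-point c')))

decompose : ∀ u v → 1 ≤ dist u v → Σ Cell λ c → u ≡ v ⊕ point c
decompose u v 1≤d with polar (u ⊖ v) in eq
... | just c  = c , trans (sym (⊖-⊕ u v)) (cong (v ⊕_) (polar-just (u ⊖ v) eq))
... | nothing = ⊥-elim (ℕₚ.<-irrefl (sym (polar-nothing (u ⊖ v) eq)) 1≤d)

one-less : ∀ (a y : ℤ) → a ℤ.+ y ≡ (a ℤ.+ (1ℤ ℤ.+ y)) - 1ℤ
one-less = solve-∀

one-more : ∀ (a y : ℤ) → a ℤ.+ ℤ.- y ≡ (a ℤ.+ ℤ.- (1ℤ ℤ.+ y)) ℤ.+ 1ℤ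
one-more = solve-∀

gap : ∀ (x c : ℤ) → x - (x ℤ.+ c) ≡ ℤ.- c
gap = solve-∀

adj-x : ∀ v q x y → Adj (v ⊕ emb q (suc x) y) (v ⊕ emb q x y)
adj-x (a , b) 0F x y = inj₂ (inj₁ (cong (_, b ℤ.+ + y) (one-less a (+ x))))
adj-x (a , b) 1F x y =
  inj₂ (inj₂ (inj₂ (cong (a ℤ.+ ℤ.- (+ y) ,_) (one-less b (+ x)))))
adj-x (a , b) 2F x y = inj₁ (cong (_, b ℤ.+ ℤ.- (+ y)) (one-more a (+ x)))
adj-x (a , b) 3F x y =
  inj₂ (inj₂ (inj₁ (cong (a ℤ.+ + y ,_) (one-more b (+ x)))))

adj-y : ∀ v q x y → Adj (v ⊕ emb q x (suc y)) (v ⊕ emb q x y)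
adj-y (a , b) 0F x y =
  inj₂ (inj₂ (inj₂ (cong (a ℤ.+ + x ,_) (one-less b (+ y)))))
adj-y (a , b) 1F x y = inj₁ (cong (_, b ℤ.+ + x) (one-more a (+ y)))
adj-y (a , b) 2F x y =
  inj₂ (inj₂ (inj₁ (cong (a ℤ.+ ℤ.- (+ x) ,_) (one-more b (+ y)))))
adj-y (a , b) 3F x y = inj₂ (inj₁ (cong (_, b ℤ.+ ℤ.- (+ x)) (one-less a (+ y))))

adj-dist : ∀ a b → Adj a b → dist a b ≡ 1
adj-dist (x , y) _ (inj₁ refl) = cong₂ _+_ (cong ∣_∣ (gap x 1ℤ)) (cong ∣_∣ (ℤₚ.+-inverseʳ y))
adj-dist (x , y) _ (inj₂ (inj₁ refl)) =
  cong₂ _+_ (cong ∣_∣ (gap x -1ℤ)) (cong ∣_∣ (ℤₚ.+-inverseʳ y))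
adj-dist (x , y) _ (inj₂ (inj₂ (inj₁ refl))) =
  cong₂ _+_ (cong ∣_∣ (ℤₚ.+-inverseʳ x)) (cong ∣_∣ (gap y 1ℤ))
adj-dist (x , y) _ (inj₂ (inj₂ (inj₂ refl))) =
  cong₂ _+_ (cong ∣_∣ (ℤₚ.+-inverseʳ x)) (cong ∣_∣ (gap y -1ℤ))

unit-cell : ∀ a b → suc (a + b) ≡ 1 → a ≡ 0 × b ≡ 0
unit-cell zero    zero    refl = refl , refl
unit-cell zero    (suc b) ()
unit-cell (suc a) b       ()

entry-neighbour : ∀ u v → Adj u v → Σ Quadrant λ q → u ≡ v ⊕ emb q 1 0
entry-neighbour u v uv with decompose u v (ℕₚ.≤-reflexive (sym (adj-dist u v uv)))
... | (q , a , b) , refl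
  with unit-cell a b (trans (sym (dist-⊕-emb v q (suc a) b)) (adj-dist _ v uv))
... | refl , refl = q , refl

tri : ℕ → ℕ
tri zero    = 0
tri (suc n) = suc n + tri n

tri≡C : ∀ n → suc n C 2 ≡ tri n
tri≡C zero    = refl
tri≡C (suc n) = trans (sym (nCk+nC[k+1]≡[n+1]C[k+1] (suc n) 1))
                      (cong₂ _+_ (nC1≡n (suc n)) (tri≡C n))

n≤tri : ∀ n → n ≤ tri n
n≤tri zero    = z≤n
n≤tri (suc n) = ℕₚ.m≤m+n (suc n) (tri n)

tri-mono : ∀ {m n} → m ≤ n → tri m ≤ tri n
tri-mono {zero}  z≤n       = z≤n
tri-mono {suc m} (s≤s m≤n) = ℕₚ.+-mono-≤ (s≤s m≤n) (tri-mono m≤n)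

-- Cantor-style numbering of the pairs (a , b): the pairs on the diagonal
-- a + b = n receive the numbers tri n, …, tri n + n.
pair : ℕ → ℕ → ℕ
pair a b = tri (a + b) + b

diagonal-below : ∀ {n b} → b ≤ n → tri n + b < tri (suc n)
diagonal-below {n} {b} b≤n = s≤s (begin
  tri n + b ≤⟨ ℕₚ.+-monoʳ-≤ (tri n) b≤n ⟩
  tri n + n ≡⟨ ℕₚ.+-comm (tri n) n ⟩
  n + tri n ∎)
  where open ℕₚ.≤-Reasoning

pair-bound : ∀ a b r → a + b < r → pair a b < tri r
pair-bound a b r a+b<r =
  ℕₚ.<-≤-trans (diagonal-below (ℕₚ.m≤n+m b a)) (tri-mono a+b<r)

diagonal-earlier : ∀ {m m' c c'} → c ≤ m → m < m' → tri m + c < tri m' + c'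
diagonal-earlier {c' = c'} c≤m m<m' =
  ℕₚ.<-≤-trans (diagonal-below c≤m) (ℕₚ.≤-trans (tri-mono m<m') (ℕₚ.m≤m+n _ c'))

diagonal-injective : ∀ {n n' b b'} → b ≤ n → b' ≤ n' →
                     tri n + b ≡ tri n' + b' → n ≡ n' × b ≡ b'
diagonal-injective {n} {n'} {b} {b'} b≤n b'≤n' e with ℕₚ.<-cmp n n'
... | tri< n<n' _ _ = ⊥-elim (ℕₚ.<-irrefl e (diagonal-earlier b≤n n<n'))
... | tri> _ _ n>n' = ⊥-elim (ℕₚ.<-irrefl (sym e) (diagonal-earlier b'≤n' n>n'))
... | tri≈ _ refl _ = refl , ℕₚ.+-cancelˡ-≡ (tri n) b b' e

pair-injective : ∀ {a b a' b'} → pair a b ≡ pair a' b' → a ≡ a' × b ≡ b'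
pair-injective {a} {b} {a'} {b'} e
  with diagonal-injective (ℕₚ.m≤n+m b a) (ℕₚ.m≤n+m b' a') e
... | n≡ , refl = ℕₚ.+-cancelʳ-≡ b a a' n≡ , refl

-- The route of the packet in cell (q , a , b): from emb q (suc a) b first
-- decrease the second coordinate to 0, then the first.  path a k gives the
-- local coordinates of the route node at distance k from the target.
path : ℕ → ℕ → ℕ × ℕ
path a k = (suc a ⊓ k , k ∸ suc a)

path-x : ∀ {a k} → k ≤ suc a → path a k ≡ (k , 0)
path-x k≤1+a = cong₂ _,_ (ℕₚ.m≥n⇒m⊓n≡n k≤1+a) (ℕₚ.m≤n⇒m∸n≡0 k≤1+a)

path-y : ∀ {a k} → suc a ≤ k → path a k ≡ (suc a , k ∸ suc a)
path-y {a} {k} 1+a≤k = cong (_, k ∸ suc a) (ℕₚ.m≤n⇒m⊓n≡m 1+a≤k)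

local : Node → Quadrant → ℕ × ℕ → Node
local v q (x , y) = v ⊕ emb q x y

onRoute : Node → Cell → ℕ → Node
onRoute v (q , a , b) k = local v q (path a k)

onRoute-source : ∀ v q a b → onRoute v (q , a , b) (suc (a + b)) ≡ v ⊕ point (q , a , b)
onRoute-source v q a b = begin
  local v q (path a (suc (a + b)))  ≡⟨ cong (local v q) (path-y (s≤s (ℕₚ.m≤m+n a b))) ⟩
  v ⊕ emb q (suc a) (a + b ∸ a)     ≡⟨ cong (λ y → v ⊕ emb q (suc a) y) (ℕₚ.m+n∸m≡n a b) ⟩
  v ⊕ emb q (suc a) b               ∎
  where open ≡-Reasoning

onRoute-target : ∀ v c → onRoute v c 0 ≡ v
onRoute-target v (q , a , b) = trans (cong (v ⊕_) (emb-origin q)) (⊕-origin v)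

onRoute-step : ∀ v c k → Adj (onRoute v c (suc k)) (onRoute v c k)
onRoute-step v (q , a , b) k with k ≤? a
... | yes k≤a = subst₂ Adj (cong (local v q) (sym (path-x (s≤s k≤a))))
                           (cong (local v q) (sym (path-x (ℕₚ.m≤n⇒m≤1+n k≤a))))
                           (adj-x v q k 0)
... | no k≰a with ℕₚ.≰⇒> k≰a
...   | s≤s {n = k'} a≤k' =
  subst₂ Adj (cong (local v q) (sym (path-y (s≤s (ℕₚ.m≤n⇒m≤1+n a≤k')))))
             (cong (local v q) (sym (path-y (s≤s a≤k'))))
             (subst (λ y → Adj (v ⊕ emb q (suc a) y) (v ⊕ emb q (suc a) (k' ∸ a)))
                    (sym (ℕₚ.+-∸-assoc 1 a≤k')) (adj-y v q (suc a) (k' ∸ a)))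

countdown-step : ∀ d A t → d ⊓ (A ∸ suc t) ≡ d ⊓ (A ∸ t) ⊎
  Σ ℕ λ k → d ⊓ (A ∸ t) ≡ suc k × d ⊓ (A ∸ suc t) ≡ k × t + suc k ≡ A
countdown-step d A t rewrite sym (ℕₚ.pred[m∸n]≡m∸[1+n] A t) with A ∸ t in left
... | zero  = inj₁ refl
... | suc k with d ≤? k
...   | yes d≤k =
  inj₁ (trans (ℕₚ.m≤n⇒m⊓n≡m d≤k) (sym (ℕₚ.m≤n⇒m⊓n≡m (ℕₚ.m≤n⇒m≤1+n d≤k))))
...   | no d≰k  =
  inj₂ (k , ℕₚ.m≥n⇒m⊓n≡n k<d , ℕₚ.m≥n⇒m⊓n≡n (ℕₚ.<⇒≤ k<d) , ends)
  where
  k<d : k < d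
  k<d = ℕₚ.≰⇒> d≰k
  t<A : t < A
  t<A = ℕₚ.m∸n≢0⇒n<m {A} {t} (λ e → ℕₚ.1+n≢0 (trans (sym left) e))
  ends : t + suc k ≡ A
  ends = trans (cong (λ n → t + n) (sym left)) (ℕₚ.m+[n∸m]≡n (ℕₚ.<⇒≤ t<A))

-- Timetable of the packet in cell (q , a , b): it arrives at time
-- arrival = pair a b + 1, having walked its route during the last
-- suc (a + b) steps; remaining c t is its distance to v at time t.
arrival : Cell → ℕ
arrival (q , a , b) = suc (pair a b)

remaining : Cell → ℕ → ℕ
remaining c@(q , a , b) t = suc (a + b) ⊓ (arrival c ∸ t)

route : Node → Cell → ℕ → Node
route v c t = onRoute v c (remaining c t)

-- The walk fits before the arrival time, as  a ≤ a + b ≤ tri (a + b).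
length≤arrival : ∀ a b → suc (a + b) ≤ suc (pair a b)
length≤arrival a b = s≤s (ℕₚ.+-monoˡ-≤ b (ℕₚ.≤-trans (ℕₚ.m≤m+n a b) (n≤tri (a + b))))

route-start : ∀ v c → route v c 0 ≡ v ⊕ point c
route-start v c@(q , a , b) =
  trans (cong (onRoute v c) (ℕₚ.m≤n⇒m⊓n≡m (length≤arrival a b))) (onRoute-source v q a b)

route-end : ∀ v c t → arrival c ≤ t → route v c t ≡ v
route-end v c@(q , a , b) t A≤t =
  trans (cong (λ e → onRoute v c (suc (a + b) ⊓ e)) (ℕₚ.m≤n⇒m∸n≡0 A≤t)) (onRoute-target v c)

route-move : ∀ v c t → StepMove (route v c t) (route v c (suc t))
route-move v c@(q , a , b) t with countdown-step (suc (a + b)) (arrival c) t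
... | inj₁ stays                = inj₁ (cong (onRoute v c) (sym stays))
... | inj₂ (k , now , next , _) =
  inj₂ (subst₂ Adj (cong (onRoute v c) (sym now)) (cong (onRoute v c) (sym next))
               (onRoute-step v c k))

route-moving : ∀ v c t → route v c t ≢ route v c (suc t) →
  Σ ℕ λ k → remaining c t ≡ suc k × t + suc k ≡ arrival c
route-moving v c@(q , a , b) t moves with countdown-step (suc (a + b)) (arrival c) t
... | inj₁ stays                 = ⊥-elim (moves (cong (onRoute v c) (sym stays)))
... | inj₂ (k , now , _ , ends) = k , now , ends

-- Full-duplex safety: two packets moving out of the same node at the same
-- time come from the same cell.  That node is  onRoute v c (suc k) =
-- v ⊕ point (q , a ⊓ k , k ∸ a), so it fixes the quadrant and the distance
-- suc k, and then  arrival = t + suc k  fixes (a , b) via pair-injective.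
routes-separate : ∀ v c c' t → route v c t ≢ route v c (suc t) → route v c' t ≢ route v c' (suc t) →
                  route v c t ≡ route v c' t → c ≡ c'
routes-separate v c@(q , a , b) c'@(q' , a' , b') t moves moves' same
  with route-moving v c t moves | route-moving v c' t moves'
... | k , now , ends | k' , now' , ends' =
  cong₂ _,_ (cong proj₁ cells) (cong₂ _,_ (proj₁ ab≡a'b') (proj₂ ab≡a'b'))
  where
  cells : (q , a ⊓ k , k ∸ a) ≡ (q' , a' ⊓ k' , k' ∸ a')
  cells = point-injective (⊕-cancelˡ v (trans (cong (onRoute v c) (sym now))
                                       (trans same (cong (onRoute v c') now'))))
  distance : Cell → ℕ
  distance (_ , x , y) = x + y
  k≡k' : k ≡ k'
  k≡k' = trans (sym (ℕₚ.m⊓n+n∸m≡n a k)) (trans (cong distance cells) (ℕₚ.m⊓n+n∸m≡n a' k'))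
  ab≡a'b' : a ≡ a' × b ≡ b'
  ab≡a'b' = pair-injective (ℕₚ.suc-injective
              (trans (sym ends) (trans (cong (λ n → t + suc n) k≡k') ends')))

cellOf : ∀ {v r} → Packet v r → Cell
cellOf {v} (u , 1≤d , _) = proj₁ (decompose u v 1≤d)

cellOf-source : ∀ {v r} (p : Packet v r) → source p ≡ v ⊕ point (cellOf p)
cellOf-source {v} (u , 1≤d , _) = proj₂ (decompose u v 1≤d)

cellOf-arrival : ∀ {v r} (p : Packet v r) → arrival (cellOf p) ≤ tri r
cellOf-arrival {v} {r} p@(u , _ , d≤r) with cellOf p | cellOf-source p
... | (q , a , b) | u≡ =
  pair-bound a b r (subst (_≤ r) (trans (cong (λ w → dist w v) u≡) (dist-⊕-emb v q (suc a) b)) d≤r)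

schedule : ∀ v r → Schedule v r (tri r)
schedule v r = record
  { pos       = λ p → route v (cellOf p)
  ; start     = λ p → trans (route-start v (cellOf p)) (sym (cellOf-source p))
  ; move      = λ p t _ → route-move v (cellOf p) t
  ; capacity  = no-collision
  ; delivered = λ p → route-end v (cellOf p) (tri r) (cellOf-arrival p)
  }
  where
  no-collision : ∀ p p' t → t < tri r → source p ≢ source p' →
                 route v (cellOf p) t ≢ route v (cellOf p) (suc t) →
                 ¬ (route v (cellOf p) t ≡ route v (cellOf p') t ×
                    route v (cellOf p) (suc t) ≡ route v (cellOf p') (suc t))
  no-collision p p' t _ p≢p' moves (same , same-next) =
    p≢p' (trans (cellOf-source p) (trans (cong (λ c → v ⊕ point c) same-cell) (sym (cellOf-source p'))))
    where
    moves' : route v (cellOf p') t ≢ route v (cellOf p') (suc t)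
    moves' e = moves (trans same (trans e (sym same-next)))
    same-cell : cellOf p ≡ cellOf p'
    same-cell = routes-separate v (cellOf p) (cellOf p') t moves moves' same

product-pigeonhole : ∀ {k m n l} (f : Fin k × Fin m → Fin n × Fin l) →
                     Injective _≡_ _≡_ f → k * m ≤ n * l
product-pigeonhole {k} {m} {n} {l} f f-inj =
  Finₚ.injective⇒≤ {f = uncurry combine ∘ f ∘ remQuot {k} m} λ {i} {j} e →
    trans (sym (Finₚ.combine-remQuot {k} m i))
          (trans (cong (uncurry combine) (f-inj (combine-inj e))) (Finₚ.combine-remQuot {k} m j))
  where
  combine-inj : Injective _≡_ _≡_ (uncurry (combine {n} {l}))
  combine-inj {x} {y} e =
    trans (sym (Finₚ.remQuot-combine (proj₁ x) (proj₂ x)))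
          (trans (cong (remQuot l) e) (Finₚ.remQuot-combine (proj₁ y) (proj₂ y)))

entry-time : ∀ {A : Set} → DecidableEquality A → (f : ℕ → A) (x : A) (T : ℕ) →
             f 0 ≢ x → f T ≡ x → Σ ℕ λ t → t < T × f t ≢ x × f (suc t) ≡ x
entry-time _≟_ f x zero    away there = ⊥-elim (away there)
entry-time _≟_ f x (suc T) away there with f T ≟ x
... | no  f[T]≢x = T , ℕₚ.n<1+n T , f[T]≢x , there
... | yes f[T]≡x with entry-time _≟_ f x T away f[T]≡x
...   | t , t<T , rest = t , ℕₚ.m<n⇒m<1+n t<T , rest

onDiagonal : (r : ℕ) → Fin (suc r) → ℕ × ℕ
onDiagonal r b = (r ∸ toℕ b , toℕ b)

pairAt : (r : ℕ) → Fin (tri r) → ℕ × ℕ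
pairAt zero    ()
pairAt (suc r) i = [ onDiagonal r , pairAt r ]′ (splitAt (suc r) i)

onDiagonal-sum : ∀ r b → uncurry _+_ (onDiagonal r b) ≡ r
onDiagonal-sum r b = ℕₚ.m∸n+n≡m (ℕₚ.≤-pred (Finₚ.toℕ<n b))

pairAt-bound : ∀ r i → uncurry _+_ (pairAt r i) < r
pairAt-bound (suc r) i with splitAt (suc r) i
... | inj₁ b = s≤s (ℕₚ.≤-reflexive (onDiagonal-sum r b))
... | inj₂ j = ℕₚ.m<n⇒m<1+n (pairAt-bound r j)

pairAt-injective : ∀ r → Injective _≡_ _≡_ (pairAt r)
pairAt-injective (suc r) {i} {j} e =
  trans (sym (Finₚ.join-splitAt (suc r) (tri r) i))
        (trans (cong (join (suc r) (tri r)) (split-injective (splitAt (suc r) i) (splitAt (suc r) j) e))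
               (Finₚ.join-splitAt (suc r) (tri r) j))
  where
  off-diagonal : ∀ b j → onDiagonal r b ≢ pairAt r j
  off-diagonal b j e = ℕₚ.<-irrefl (trans (cong (uncurry _+_) (sym e)) (onDiagonal-sum r b))
                                    (pairAt-bound r j)
  split-injective : ∀ x y → [ onDiagonal r , pairAt r ]′ x ≡ [ onDiagonal r , pairAt r ]′ y → x ≡ y
  split-injective (inj₁ b) (inj₁ b') e = cong inj₁ (Finₚ.toℕ-injective (cong proj₂ e))
  split-injective (inj₁ b) (inj₂ j') e = ⊥-elim (off-diagonal b j' e)
  split-injective (inj₂ j) (inj₁ b') e = ⊥-elim (off-diagonal b' j (sym e))
  split-injective (inj₂ j) (inj₂ j') e = cong inj₂ (pairAt-injective r e)

packetAt : (v : Node) (r : ℕ) → Fin (tri r) × Quadrant → Packet v r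
packetAt v r (i , q) =
  v ⊕ point (q , pairAt r i) , subst (1 ≤_) (sym d) (s≤s z≤n) , subst (_≤ r) (sym d) (pairAt-bound r i)
  where
  d : dist (v ⊕ point (q , pairAt r i)) v ≡ suc (uncurry _+_ (pairAt r i))
  d = dist-⊕-emb v q (suc (proj₁ (pairAt r i))) (proj₂ (pairAt r i))

packetAt-injective : ∀ v r {x y} → source (packetAt v r x) ≡ source (packetAt v r y) → x ≡ y
packetAt-injective v r {x} {y} e = cong₂ _,_ (pairAt-injective r (cong proj₂ cells)) (cong proj₁ cells)
  where
  cells : (proj₂ x , pairAt r (proj₁ x)) ≡ (proj₂ y , pairAt r (proj₁ y))
  cells = point-injective (⊕-cancelˡ v e)

_≟ₙ_ : DecidableEquality Node
_≟ₙ_ = Productₚ.≡-dec ℤₚ._≟_ ℤₚ._≟_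

module LowerBound {v : Node} {r T : ℕ} (sch : Schedule v r T) where
  open Schedule sch

  record Entry (p : Packet v r) : Set where
    field
      time     : ℕ
      in-time  : time < T
      through  : Quadrant
      at-door  : pos p time ≡ v ⊕ emb through 1 0
      away     : pos p time ≢ v
      arrives  : pos p (suc time) ≡ v

  starts-away : ∀ p → pos p 0 ≢ v
  starts-away p at-v = ℕₚ.<-irrefl (sym (trans (cong (λ u → dist u v) (trans (sym (start p)) at-v))
                                              (dist-self v)))
                                   (proj₁ (proj₂ p))

  entry : ∀ p → Entry p
  entry p with entry-time _≟ₙ_ (pos p) v T (starts-away p) (delivered p)
  ... | t , t<T , away , arrives = record
    { time = t ; in-time = t<T ; through = proj₁ door ; at-door = proj₂ door
    ; away = away ; arrives = arrives }
    where
    step-in : Adj (pos p t) v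
    step-in with move p t t<T
    ... | inj₁ stays = ⊥-elim (away (trans stays arrives))
    ... | inj₂ edge  = subst (Adj (pos p t)) arrives edge
    door : Σ Quadrant λ q → pos p t ≡ v ⊕ emb q 1 0
    door = entry-neighbour (pos p t) v step-in

  slot : Packet v r → Fin T × Quadrant
  slot p = fromℕ< in-time , through
    where open Entry (entry p)

  slot-injective : ∀ p p' → slot p ≡ slot p' → source p ≡ source p'
  slot-injective p p' e = decidable-stable (source p ≟ₙ source p') λ p≢p' →
    capacity p p' time in-time p≢p' (λ e → away (trans e arrives)) (same-door , same-target)
    where
    open Entry (entry p)
    module E' = Entry (entry p')
    t≡t' : time ≡ E'.time
    t≡t' = Finₚ.fromℕ<-injective time E'.time in-time E'.in-time (cong proj₁ e)
    same-door : pos p time ≡ pos p' time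
    same-door = trans at-door (trans (cong (λ q → v ⊕ emb q 1 0) (cong proj₂ e))
                                     (trans (sym E'.at-door) (cong (pos p') (sym t≡t'))))
    same-target : pos p (suc time) ≡ pos p' (suc time)
    same-target = trans arrives (trans (sym E'.arrives) (cong (pos p' ∘ suc) (sym t≡t')))

  bound : tri r ≤ T
  bound = ℕₚ.*-cancelʳ-≤ (tri r) T 4
    (product-pigeonhole (slot ∘ packetAt v r)
      (λ e → packetAt-injective v r (slot-injective (packetAt v r _) (packetAt v r _) e)))

mainTheorem5 : (v : Node) (r : ℕ) → 1 ≤ r →
    Schedule v r ((suc r) C 2) × (∀ T → T < (suc r) C 2 → ¬ Schedule v r T)
mainTheorem5 v r _ =
  subst (Schedule v r) (sym (tri≡C r)) (schedule v r) ,
  λ T T<C sch → ℕₚ.<⇒≱ (subst (T <_) (tri≡C r) T<C) (LowerBound.bound sch)
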